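{- Let $n \geq 4$ and let $S$ be a $4$-cap free, $n$-cup free configuration. Suppose $S$ contains an $(n-1)$-cup $C$ from $x$ to $y$, an $(n-2)$-cup $C_x$ that ends with $x$, and an $(n-2)$-cup $C_y$ that starts with $y$. Then $S$ contains a pair of interweaved laced $(n-1)$-cups.
   Context: A configuration is a finite set $S$ with a linear order $<$, together with an arbitrary assignment, to each $3$-element subset, of "cap" or "cup". Points $x_1 < \cdots < x_m$ form an $m$-cup (resp. $m$-cap) if every consecutive triple $x_{i-1}x_ix_{i+1}$ is labeled cup (resp. cap); 1- and 2-element sets count as both; it is a cup from $x_1$ (starting point) to $x_m$ (ending point), and its size is $m$. Two cups from $p$ to $r$ and from $q$ to $s$ respectively are interweaved if $p < q \leq r < s$. An $(n-1)$-cup from $p$ to $q$ is laced if there exist a cup $C_p$ ending with $p$ and a cup $C_q$ starting with $q$ with $|C_p| + |C_q| = n-1$. -}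

module Defs where

open import Data.Nat using (ℕ)
open import Data.Fin using (Fin; _<_; _≤_)
open import Data.List using (List; []; _∷_; length; head; last)
open import Data.List.Relation.Unary.Linked using (Linked)
open import Data.Maybe using (just)
open import Data.Product using (Σ; _×_; ∃; ∃-syntax)
open import Relation.Binary.PropositionalEquality using (_≡_)
open import Relation.Nullary using (¬_)

data Label : Set where
  cup cap : Label

-- A configuration on N points: the underlying set is Fin N with its
-- natural linear order; the label of the 3-subset {i<j<k} is lab i j k
-- (values on non-increasing triples are irrelevant).
Config : ℕ → Set
Config N = Fin N → Fin N → Fin N → Label

module _ {N : ℕ} (S : Config N) where

  data TriplesLabeled (ℓ : Label) : List (Fin N) → Set where
    nil   : TriplesLabeled ℓ []
    one   : ∀ x → TriplesLabeled ℓ (x ∷ [])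
    two   : ∀ x y → TriplesLabeled ℓ (x ∷ y ∷ [])
    more  : ∀ x y z zs → S x y z ≡ ℓ → TriplesLabeled ℓ (y ∷ z ∷ zs)
          → TriplesLabeled ℓ (x ∷ y ∷ z ∷ zs)

  IsCup : List (Fin N) → Set
  IsCup xs = Linked _<_ xs × TriplesLabeled cup xs

  IsCap : List (Fin N) → Set
  IsCap xs = Linked _<_ xs × TriplesLabeled cap xs

  IsMCup : ℕ → List (Fin N) → Set
  IsMCup m xs = IsCup xs × length xs ≡ m

  IsMCap : ℕ → List (Fin N) → Set
  IsMCap m xs = IsCap xs × length xs ≡ m

  CupFree : ℕ → Set
  CupFree m = ¬ (Σ (List (Fin N)) (IsMCup m))

  CapFree : ℕ → Set
  CapFree m = ¬ (Σ (List (Fin N)) (IsMCap m))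

  StartsWith : List (Fin N) → Fin N → Set
  StartsWith xs p = head xs ≡ just p

  EndsWith : List (Fin N) → Fin N → Set
  EndsWith xs p = last xs ≡ just p

  CupFromTo : ℕ → Fin N → Fin N → List (Fin N) → Set
  CupFromTo m p q xs = IsMCup m xs × StartsWith xs p × EndsWith xs q

  -- an (n-1)-cup from p to q is laced (the list is an (n-1)-cup from p to q
  -- and there are cups C_p ending with p, C_q starting with q,
  -- |C_p| + |C_q| = n - 1). Here m plays the role of n - 1.
  LacedCupFromTo : ℕ → Fin N → Fin N → List (Fin N) → Set
  LacedCupFromTo m p q xs =
    CupFromTo m p q xs ×
    ∃[ Cp ] ∃[ Cq ] (IsCup Cp × EndsWith Cp p × IsCup Cq × StartsWith Cq q
                     × length Cp Data.Nat.+ length Cq ≡ m)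

  HasInterweavedLacedPair : ℕ → Set
  HasInterweavedLacedPair m =
    ∃[ p ] ∃[ q ] ∃[ r ] ∃[ s ] ∃[ C₁ ] ∃[ C₂ ]
      (LacedCupFromTo m p r C₁ × LacedCupFromTo m q s C₂ ×
       p < q × q ≤ r × r < s)

-- Write C = x c₂ c₃ … p q y, let a be the point of Cx before x and b₂ the point of Cy after y.
-- Since neither a nor b₂ extends C to an n-cup, a x c₂ and q y b₂ are caps; since there is no
-- 4-cap, two triples u v w and v w z of increasing points are never both caps, and this decides
-- every further label the argument needs. If a c₂ c₃ is a cup, replacing x by a in C gives a
-- laced cup ending at y, and otherwise Cx without x followed by c₂ y is one; both start before x.
-- Symmetrically, according to the label of p q b₂, replacing y by b₂ in C, or x q followed by Cy
-- without y, is a laced cup starting at x and ending after y. These two laced cups interweave.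
module Submission where

open import Defs
open import Data.Nat using (ℕ; zero; suc; _+_; _∸_; _≤_; z≤n; s≤s)
open import Data.Nat.Properties using (+-comm; suc-injective; <⇒≤)
open import Data.Fin using (Fin; _<_)
open import Data.Fin.Properties using (<-trans)
open import Data.List using (List; []; _∷_; _++_; _∷ʳ_; length; head; last)
open import Data.List.Properties using (length-++; length-++-comm)
open import Data.List.Relation.Unary.Linked as Linked using (Linked; []; [-]; _∷_)
open import Data.List.Relation.Unary.Linked.Properties using (++⁺)
open import Data.Maybe using (just)
open import Data.Maybe.Properties using (just-injective)
open import Data.Maybe.Relation.Binary.Connected using (Connected)
open import Data.Product using (_×_; _,_; proj₁; proj₂; ∃-syntax)
open import Data.Empty using (⊥-elim)
open import Relation.Binary using (Rel; Transitive)
open import Relation.Binary.PropositionalEquality using (_≡_; refl; sym; trans; cong; subst; module ≡-Reasoning)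
open ≡-Reasoning

module _ {A : Set} where

  last-++-∷ : ∀ (xs : List A) y ys → last (xs ++ y ∷ ys) ≡ last (y ∷ ys)
  last-++-∷ []           y ys = refl
  last-++-∷ (_ ∷ [])     y ys = refl
  last-++-∷ (_ ∷ x ∷ xs) y ys = last-++-∷ (x ∷ xs) y ys

  last-∷ʳ : ∀ (xs : List A) a → last (xs ∷ʳ a) ≡ just a
  last-∷ʳ xs a = last-++-∷ xs a []

  ∷ʳ-last : ∀ (xs : List A) {a b} → last (xs ∷ʳ a) ≡ just b → a ≡ b
  ∷ʳ-last xs {a} eq = just-injective (trans (sym (last-∷ʳ xs a)) eq)

  last-∷-∃ : ∀ (x : A) xs → ∃[ z ] last (x ∷ xs) ≡ just z
  last-∷-∃ x []       = x , refl
  last-∷-∃ x (y ∷ xs) = last-∷-∃ y xs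

  head-∷ʳ-∃ : ∀ (xs : List A) a → ∃[ h ] head (xs ∷ʳ a) ≡ just h
  head-∷ʳ-∃ []      a = a , refl
  head-∷ʳ-∃ (x ∷ _) a = x , refl

  head-++ : ∀ {xs : List A} {h} ys → head xs ≡ just h → head (xs ++ ys) ≡ just h
  head-++ {_ ∷ _} ys refl = refl

  length-∷ʳ : ∀ (xs : List A) a → length (xs ∷ʳ a) ≡ suc (length xs)
  length-∷ʳ xs a = length-++-comm xs (a ∷ [])

  split-last : ∀ (xs : List A) {m} → length xs ≡ suc m →
               ∃[ ys ] ∃[ z ] (xs ≡ ys ∷ʳ z × length ys ≡ m)
  split-last (x ∷ [])     {zero}  refl = [] , x , refl , refl
  split-last (x ∷ y ∷ xs) {suc m} eq
    with ys , z , split , len ← split-last (y ∷ xs) (suc-injective eq)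
    = x ∷ ys , z , cong (x ∷_) split , cong suc len

module _ {A : Set} {ℓ} {R : Rel A ℓ} where

  linked-init : ∀ (xs : List A) {a} → Linked R (xs ∷ʳ a) → Linked R xs
  linked-init []           _       = []
  linked-init (_ ∷ [])     _       = [-]
  linked-init (_ ∷ y ∷ xs) (r ∷ l) = r ∷ linked-init (y ∷ xs) l

  linked-predecessor : ∀ (xs : List A) {a w} → Linked R (xs ∷ʳ a) → last xs ≡ just w → R w a
  linked-predecessor (_ ∷ [])     (r ∷ _) refl = r
  linked-predecessor (_ ∷ y ∷ xs) (_ ∷ l) eq   = linked-predecessor (y ∷ xs) l eq

  linked-first : ∀ {a b} (ys : List A) → Linked R (a ∷ ys) → head ys ≡ just b → R a b
  linked-first (_ ∷ _) (r ∷ _) refl = r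

  module _ (R-trans : Transitive R) where

    linked-last : ∀ {a z} (xs : List A) → Linked R (a ∷ xs) → last xs ≡ just z → R a z
    linked-last (_ ∷ [])     (r ∷ _) refl = r
    linked-last (_ ∷ y ∷ xs) (r ∷ l) eq   = R-trans r (linked-last (y ∷ xs) l eq)

    linked-head : ∀ (xs : List A) {a h} → Linked R (xs ∷ʳ a) → head xs ≡ just h → R h a
    linked-head (_ ∷ xs) {a} l refl = linked-last (xs ∷ʳ a) l (last-∷ʳ xs a)

module _ {N : ℕ} (S : Config N) where

  labeled-init : ∀ {ℓ} (xs : List (Fin N)) {a} →
                 TriplesLabeled S ℓ (xs ∷ʳ a) → TriplesLabeled S ℓ xs
  labeled-init []               _                  = nil
  labeled-init (x ∷ [])         _                  = one x
  labeled-init (x ∷ y ∷ [])     _                  = two x y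
  labeled-init (x ∷ y ∷ z ∷ xs) (more _ _ _ _ e t) = more x y z xs e (labeled-init (y ∷ z ∷ xs) t)

  labeled-tail : ∀ {ℓ x xs} → TriplesLabeled S ℓ (x ∷ xs) → TriplesLabeled S ℓ xs
  labeled-tail (one _)            = nil
  labeled-tail (two _ y)          = one y
  labeled-tail (more _ _ _ _ _ t) = t

  labeled-glue : ∀ {ℓ} (xs : List (Fin N)) {a ys} →
    TriplesLabeled S ℓ (xs ∷ʳ a) → TriplesLabeled S ℓ (a ∷ ys) →
    (∀ {w b} → last xs ≡ just w → head ys ≡ just b → S w a b ≡ ℓ) →
    TriplesLabeled S ℓ (xs ∷ʳ a ++ ys)
  labeled-glue []               _                   t₂ _        = t₂
  labeled-glue (w ∷ []) {ys = []}     _             _  _        = two w _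
  labeled-glue (w ∷ []) {ys = b ∷ ys} _             t₂ junction =
    more w _ b ys (junction refl refl) t₂
  labeled-glue (w ∷ v ∷ [])     (more _ _ _ _ e t₁) t₂ junction =
    more w v _ _ e (labeled-glue (v ∷ []) t₁ t₂ junction)
  labeled-glue (w ∷ v ∷ u ∷ xs) (more _ _ _ _ e t₁) t₂ junction =
    more w v u _ e (labeled-glue (v ∷ u ∷ xs) t₁ t₂ junction)

  cap₄ : ∀ {a b c d} → a < b → b < c → c < d → S a b c ≡ cap → S b c d ≡ cap →
         IsMCap S 4 (a ∷ b ∷ c ∷ d ∷ [])
  cap₄ a<b b<c c<d abc bcd =
    (a<b ∷ b<c ∷ c<d ∷ [-] , more _ _ _ _ abc (more _ _ _ _ bcd (two _ _))) , refl

  cup₂ : ∀ {a b} → a < b → IsCup S (a ∷ b ∷ [])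
  cup₂ a<b = a<b ∷ [-] , two _ _

  cup-∷ : ∀ {a b c xs} → a < b → S a b c ≡ cup → IsCup S (b ∷ c ∷ xs) →
          IsCup S (a ∷ b ∷ c ∷ xs)
  cup-∷ a<b abc (lk , t) = a<b ∷ lk , more _ _ _ _ abc t

  cup-init : ∀ (xs : List (Fin N)) {a} → IsCup S (xs ∷ʳ a) → IsCup S xs
  cup-init xs (lk , t) = linked-init xs lk , labeled-init xs t

  cup-tail : ∀ {x xs} → IsCup S (x ∷ xs) → IsCup S xs
  cup-tail (lk , t) = Linked.tail lk , labeled-tail t

  cup-first<last : ∀ {m x y C} → CupFromTo S (2 + m) x y C → x < y
  cup-first<last {C = _ ∷ b ∷ C} ((C-cup , _) , refl , C-last) =
    linked-last <-trans (b ∷ C) (proj₁ C-cup) C-last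

  cup-glue : ∀ (xs : List (Fin N)) {a ys} → IsCup S (xs ∷ʳ a) → IsCup S (a ∷ ys) →
    (∀ {w b} → last xs ≡ just w → head ys ≡ just b → S w a b ≡ cup) →
    IsCup S (xs ∷ʳ a ++ ys)
  cup-glue xs {a} {ys} (lk₁ , t₁) (lk₂ , t₂) junction =
    ++⁺ lk₁ (subst (λ l → Connected _<_ l (head ys)) (sym (last-∷ʳ xs a)) (Linked.head′ lk₂))
        (Linked.tail lk₂) ,
    labeled-glue xs t₁ t₂ junction

  cup-∷ʳ : ∀ (xs : List (Fin N)) {a b c} →
           IsCup S (xs ∷ʳ a ∷ʳ b) → b < c → S a b c ≡ cup →
           IsCup S (xs ∷ʳ a ∷ʳ b ∷ʳ c)
  cup-∷ʳ xs {a} {b} {c} ab-cup b<c abc = cup-glue (xs ∷ʳ a) ab-cup (cup₂ b<c) junction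
    where
    junction : ∀ {w d} → last (xs ∷ʳ a) ≡ just w → head (c ∷ []) ≡ just d → S w b d ≡ cup
    junction w-last refl with refl ← ∷ʳ-last xs w-last = abc

module _ {N : ℕ} {S : Config N} (no-4-cap : CapFree S 4) where

  capˡ⇒cupʳ : ∀ {a b c d} → a < b → b < c → c < d → S a b c ≡ cap → S b c d ≡ cup
  capˡ⇒cupʳ {b = b} {c} {d} a<b b<c c<d abc with S b c d in bcd
  ... | cup = refl
  ... | cap = ⊥-elim (no-4-cap (_ , cap₄ S a<b b<c c<d abc bcd))

  capʳ⇒cupˡ : ∀ {a b c d} → a < b → b < c → c < d → S b c d ≡ cap → S a b c ≡ cup
  capʳ⇒cupˡ {a} {b} {c} a<b b<c c<d bcd with S a b c in abc
  ... | cup = refl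
  ... | cap = ⊥-elim (no-4-cap (_ , cap₄ S a<b b<c c<d abc bcd))

module Interweaving {N : ℕ} (S : Config N) (k : ℕ)
                    (no-4-cap : CapFree S 4) (no-n-cup : CupFree S (4 + k)) where

  laced-cup-ending-at′ : ∀ {Jx a x y c₂ c₃ Cr b₂ Cyr} →
    IsMCup S (2 + k) (Jx ∷ʳ a ∷ʳ x) → CupFromTo S (3 + k) x y (x ∷ c₂ ∷ c₃ ∷ Cr) →
    IsMCup S (2 + k) (y ∷ b₂ ∷ Cyr) →
    ∃[ p ] ∃[ D ] (LacedCupFromTo S (3 + k) p y D × p < x)
  laced-cup-ending-at′ {Jx} {a} {x} {y} {c₂} {c₃} {Cr} {b₂} {Cyr}
    (Cx-cup , Cx-len) ((C-cup , C-len) , _ , C-y) (Cy-cup , Cy-len) = by-label (S a c₂ c₃) refl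
    where
    x<c₂ : x < c₂
    x<c₂ = Linked.head (proj₁ C-cup)
    c₂<c₃ : c₂ < c₃
    c₂<c₃ = Linked.head (Linked.tail (proj₁ C-cup))
    c₂<y : c₂ < y
    c₂<y = linked-last <-trans (c₃ ∷ Cr) (Linked.tail (proj₁ C-cup)) C-y
    a<x : a < x
    a<x = linked-predecessor (Jx ∷ʳ a) (proj₁ Cx-cup) (last-∷ʳ Jx a)
    a<c₂ : a < c₂
    a<c₂ = <-trans a<x x<c₂
    y<b₂ : y < b₂
    y<b₂ = Linked.head (proj₁ Cy-cup)
    Jxa-cup : IsCup S (Jx ∷ʳ a)
    Jxa-cup = cup-init S (Jx ∷ʳ a) Cx-cup
    Jxa-len : length (Jx ∷ʳ a) ≡ 1 + k
    Jxa-len = suc-injective (trans (sym (length-∷ʳ (Jx ∷ʳ a) x)) Cx-len)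
    Jxa-len+2 : length (Jx ∷ʳ a) + 2 ≡ 3 + k
    Jxa-len+2 = trans (cong (_+ 2) Jxa-len) (+-comm (1 + k) 2)

    -- otherwise a followed by C would be an n-cup
    axc₂ : S a x c₂ ≡ cap
    axc₂ with S a x c₂ in axc₂
    ... | cap = refl
    ... | cup = ⊥-elim (no-n-cup (_ , cup-∷ S a<x axc₂ C-cup , cong suc C-len))

    by-label : ∀ l → S a c₂ c₃ ≡ l → ∃[ p ] ∃[ D ] (LacedCupFromTo S (3 + k) p y D × p < x)
    by-label cup ac₂c₃ =
      a , a ∷ c₂ ∷ c₃ ∷ Cr ,
      (((cup-∷ S a<c₂ ac₂c₃ (cup-tail S C-cup) , C-len) , refl , C-y) ,
       Jx ∷ʳ a , y ∷ b₂ ∷ [] , Jxa-cup , last-∷ʳ Jx a ,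
       cup₂ S y<b₂ , refl , Jxa-len+2) ,
      a<x
    by-label cap ac₂c₃ =
      p , Jx ∷ʳ a ++ c₂ ∷ y ∷ [] ,
      (((E-cup , trans (length-++ (Jx ∷ʳ a)) Jxa-len+2) ,
        head-++ (c₂ ∷ y ∷ []) p-first , last-++-∷ (Jx ∷ʳ a) c₂ (y ∷ [])) ,
       p ∷ [] , y ∷ b₂ ∷ Cyr , ([-] , one p) , refl , Cy-cup , refl , cong suc Cy-len) ,
      linked-head <-trans (Jx ∷ʳ a) (proj₁ Cx-cup) p-first
      where
      p : Fin N
      p = proj₁ (head-∷ʳ-∃ Jx a)
      p-first : head (Jx ∷ʳ a) ≡ just p
      p-first = proj₂ (head-∷ʳ-∃ Jx a)

      -- otherwise x c₂ y followed by Cy would be an n-cup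
      ac₂y : S a c₂ y ≡ cup
      ac₂y with S a c₂ y in ac₂y
      ... | cup = refl
      ... | cap = ⊥-elim (no-n-cup (_ ,
                    cup-∷ S x<c₂ (capˡ⇒cupʳ no-4-cap a<x x<c₂ c₂<y axc₂)
                      (cup-∷ S c₂<y (capˡ⇒cupʳ no-4-cap a<c₂ c₂<y y<b₂ ac₂y) Cy-cup) ,
                    cong (2 +_) Cy-len))

      E-cup : IsCup S (Jx ∷ʳ a ++ c₂ ∷ y ∷ [])
      E-cup = cup-glue S Jx Jxa-cup (cup-∷ S a<c₂ ac₂y (cup₂ S c₂<y))
        λ { w-last refl →
              capʳ⇒cupˡ no-4-cap (linked-predecessor Jx (proj₁ Jxa-cup) w-last)
                a<c₂ c₂<c₃ ac₂c₃ }

  laced-cup-starting-at′ : ∀ {Lx x K q y b₂ Cyr} →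
    IsMCup S (2 + k) (Lx ∷ʳ x) → CupFromTo S (3 + k) x y (x ∷ K ∷ʳ q ∷ʳ y) →
    IsMCup S (2 + k) (y ∷ b₂ ∷ Cyr) →
    ∃[ s ] ∃[ D ] (LacedCupFromTo S (3 + k) x s D × y < s)
  laced-cup-starting-at′ {Lx} {x} {K} {q} {y} {b₂} {Cyr}
    (Cx-cup , Cx-len) ((C-cup , C-len) , _ , _) (Cy-cup , Cy-len) = by-label (S p q b₂) refl
    where
    M-cup : IsCup S (x ∷ K ∷ʳ q)
    M-cup = cup-init S (x ∷ K ∷ʳ q) C-cup
    q<y : q < y
    q<y = linked-predecessor (x ∷ K ∷ʳ q) (proj₁ C-cup) (last-∷ʳ (x ∷ K) q)
    x<q : x < q
    x<q = linked-head <-trans (x ∷ K) (proj₁ M-cup) refl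
    y<b₂ : y < b₂
    y<b₂ = Linked.head (proj₁ Cy-cup)
    q<b₂ : q < b₂
    q<b₂ = <-trans q<y y<b₂
    p : Fin N
    p = proj₁ (last-∷-∃ x K)
    p-last : last (x ∷ K) ≡ just p
    p-last = proj₂ (last-∷-∃ x K)
    p<q : p < q
    p<q = linked-predecessor (x ∷ K) (proj₁ M-cup) p-last
    Cx-len+1 : length (Lx ∷ʳ x) + 1 ≡ 3 + k
    Cx-len+1 = trans (cong (_+ 1) Cx-len) (+-comm (2 + k) 1)

    -- otherwise C followed by b₂ would be an n-cup
    qyb₂ : S q y b₂ ≡ cap
    qyb₂ with S q y b₂ in qyb₂
    ... | cap = refl
    ... | cup = ⊥-elim (no-n-cup (_ , cup-∷ʳ S (x ∷ K) C-cup y<b₂ qyb₂ ,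
                                  trans (length-∷ʳ (x ∷ K ∷ʳ q ∷ʳ y) b₂) (cong suc C-len)))

    by-label : ∀ l → S p q b₂ ≡ l → ∃[ s ] ∃[ D ] (LacedCupFromTo S (3 + k) x s D × y < s)
    by-label cup pqb₂ =
      b₂ , x ∷ K ∷ʳ q ∷ʳ b₂ ,
      (((cup-glue S (x ∷ K) M-cup (cup₂ S q<b₂) junction , D-len) ,
        refl , last-∷ʳ (x ∷ K ∷ʳ q) b₂) ,
       Lx ∷ʳ x , b₂ ∷ [] , Cx-cup , last-∷ʳ Lx x , ([-] , one b₂) , refl , Cx-len+1) ,
      y<b₂
      where
      junction : ∀ {w d} → last (x ∷ K) ≡ just w → head (b₂ ∷ []) ≡ just d → S w q d ≡ cup
      junction w-last refl with refl ← trans (sym p-last) w-last = pqb₂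
      D-len : length (x ∷ K ∷ʳ q ∷ʳ b₂) ≡ 3 + k
      D-len = begin
        length (x ∷ K ∷ʳ q ∷ʳ b₂) ≡⟨ length-∷ʳ (x ∷ K ∷ʳ q) b₂ ⟩
        suc (length (x ∷ K ∷ʳ q)) ≡⟨ length-∷ʳ (x ∷ K ∷ʳ q) y ⟨
        length (x ∷ K ∷ʳ q ∷ʳ y)  ≡⟨ C-len ⟩
        3 + k                     ∎
    by-label cap pqb₂ =
      s , x ∷ q ∷ b₂ ∷ Cyr ,
      (((cup-∷ S x<q xqb₂ qb₂Cyr-cup , cong suc Cy-len) , refl , s-last) ,
       Lx ∷ʳ x , s ∷ [] , Cx-cup , last-∷ʳ Lx x , ([-] , one s) , refl , Cx-len+1) ,
      linked-last <-trans (b₂ ∷ Cyr) (proj₁ Cy-cup) s-last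
      where
      s : Fin N
      s = proj₁ (last-∷-∃ b₂ Cyr)
      s-last : last (b₂ ∷ Cyr) ≡ just s
      s-last = proj₂ (last-∷-∃ b₂ Cyr)

      qb₂Cyr-cup : IsCup S (q ∷ b₂ ∷ Cyr)
      qb₂Cyr-cup = cup-glue S (q ∷ []) (cup₂ S q<b₂) (cup-tail S Cy-cup)
        λ { refl z-first →
              capˡ⇒cupʳ no-4-cap p<q q<b₂ (linked-first Cyr (Linked.tail (proj₁ Cy-cup)) z-first)
                pqb₂ }

      -- otherwise Cx followed by q y would be an n-cup
      xqb₂ : S x q b₂ ≡ cup
      xqb₂ with S x q b₂ in xqb₂
      ... | cup = refl
      ... | cap = ⊥-elim (no-n-cup (_ ,
                    cup-glue S Lx Cx-cup
                      (cup-∷ S x<q (capʳ⇒cupˡ no-4-cap x<q q<y y<b₂ qyb₂) (cup₂ S q<y))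
                      (λ { w-last refl →
                             capʳ⇒cupˡ no-4-cap (linked-predecessor Lx (proj₁ Cx-cup) w-last)
                               x<q q<b₂ xqb₂ }) ,
                    trans (length-++ (Lx ∷ʳ x)) (trans (cong (_+ 2) Cx-len) (+-comm (2 + k) 2))))

  laced-cup-ending-at : ∀ {x y C Cx Cy} →
    CupFromTo S (3 + k) x y C → IsMCup S (2 + k) Cx → EndsWith S Cx x →
    IsMCup S (2 + k) Cy → StartsWith S Cy y →
    ∃[ p ] ∃[ D ] (LacedCupFromTo S (3 + k) p y D × p < x)
  laced-cup-ending-at {C = _ ∷ _ ∷ _ ∷ _} {Cx} {Cy = _ ∷ _ ∷ _}
                      C-cup@(_ , refl , _) (Cx-cup , Cx-len) Cx-x Cy-cup refl
    with Lx , _ , refl , Lx-len ← split-last Cx Cx-len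
    with refl ← ∷ʳ-last Lx Cx-x
    with _ , _ , refl , _ ← split-last Lx Lx-len
    = laced-cup-ending-at′ (Cx-cup , Cx-len) C-cup Cy-cup
  laced-cup-ending-at {C = []}          (_ , () , _) _ _ _ _
  laced-cup-ending-at {C = _ ∷ []}      ((_ , ()) , _) _ _ _ _
  laced-cup-ending-at {C = _ ∷ _ ∷ []}  ((_ , ()) , _) _ _ _ _
  laced-cup-ending-at {Cy = []}         _ _ _ _ ()
  laced-cup-ending-at {Cy = _ ∷ []}     _ _ _ (_ , ()) _

  laced-cup-starting-at : ∀ {x y C Cx Cy} →
    CupFromTo S (3 + k) x y C → IsMCup S (2 + k) Cx → EndsWith S Cx x →
    IsMCup S (2 + k) Cy → StartsWith S Cy y →
    ∃[ s ] ∃[ D ] (LacedCupFromTo S (3 + k) x s D × y < s)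
  laced-cup-starting-at {C = x ∷ Cᵢ} {Cx} {Cy = _ ∷ _ ∷ _}
                        ((C-cup , C-len) , refl , C-y) (Cx-cup , Cx-len) Cx-x Cy-cup refl
    with Lx , _ , refl , _ ← split-last Cx Cx-len
    with refl ← ∷ʳ-last Lx Cx-x
    with Mᵢ , _ , refl , Mᵢ-len ← split-last Cᵢ (suc-injective C-len)
    with refl ← ∷ʳ-last (x ∷ Mᵢ) C-y
    with _ , _ , refl , _ ← split-last Mᵢ Mᵢ-len
    = laced-cup-starting-at′ (Cx-cup , Cx-len) ((C-cup , C-len) , refl , C-y) Cy-cup
  laced-cup-starting-at {C = []}        (_ , () , _) _ _ _ _
  laced-cup-starting-at {Cy = []}       _ _ _ _ ()
  laced-cup-starting-at {Cy = _ ∷ []}   _ _ _ (_ , ()) _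

open Interweaving using (laced-cup-ending-at; laced-cup-starting-at)

lemma5p3 : (n : ℕ) → 4 ≤ n → (N : ℕ) → (S : Config N) →
    CapFree S 4 → CupFree S n →
    (x y : Fin N) (C Cx Cy : List (Fin N)) →
    CupFromTo S (n ∸ 1) x y C →
    IsMCup S (n ∸ 2) Cx → EndsWith S Cx x →
    IsMCup S (n ∸ 2) Cy → StartsWith S Cy y →
    HasInterweavedLacedPair S (n ∸ 1)
lemma5p3 (suc (suc (suc (suc k)))) (s≤s (s≤s (s≤s (s≤s z≤n)))) N S no-4-cap no-n-cup x y C Cx Cy
         C-cup Cx-cup Cx-x Cy-cup Cy-y
  with p , D₁ , D₁-laced , p<x ← laced-cup-ending-at S k no-4-cap no-n-cup C-cup Cx-cup Cx-x Cy-cup Cy-y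
  with s , D₂ , D₂-laced , y<s ← laced-cup-starting-at S k no-4-cap no-n-cup C-cup Cx-cup Cx-x Cy-cup Cy-y
  = p , x , y , s , D₁ , D₂ , D₁-laced , D₂-laced , p<x , <⇒≤ (cup-first<last S C-cup) , y<s
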